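{- Let $t=[\![T]\!]_{\pi^*}$ be a term of support size $\ell$ with $1\in T$ and $\pi^*(1)=1$, and let $N$ be a normalized DNF of support size $h$ that is a weakening of $M_1=\bigvee_{j\in[n]\setminus\{1\}}x_{j,1}$ (i.e. $M_1$ implies $N$). Then there is a DNF $N'$ such that: (1) for every total order $x$, $N'(x)\Leftrightarrow N(x)\wedge t(x)$, hence $N'$ is a weakening of $M_1\wedge t$ (in the sense that every total order satisfying $M_1\wedge t$ satisfies $N'$); (2) $N'$ is normalized with support size at most $\ell+h$ and degree at most $\ell+h-1\le\deg(N)+\deg(t)+1$; (3) $\tilde{\mathbb{E}}[Nt]=\tilde{\mathbb{E}}[N'+1-t]$.
   Context: Variables $x_{i,j}$, $i,j\in[n]$. A total order on $[n]$ is identified with the assignment $x_{i,j}=1$ iff $i$ precedes $j$. Let $\mathrm{Ord}$ be the set of total orders. Terms are identified with polynomials ($\prod$ of positive $x_{i,j}$ times $\prod(1-x_{i,j})$ over negated ones), a DNF $D=\bigvee_{s\in D}s$ with $\sum_{s\in D}s-1$ (so $N'+1-t=\sum_{s\in N'}s-t$); products are multilinear. $\tilde{\mathbb{E}}[p]=\frac{1}{|\mathrm{Ord}|}\sum_{z\in\mathrm{Ord}}p(z)$. For $S\subseteq[n]$, $|S|\ge2$, and a bijection $\pi:[|S|]\to S$, $[\![S]\!]_\pi$ is the term $x_{\pi(1),\pi(2)}\cdots x_{\pi(|S|-1),\pi(|S|)}$, whose support is $S$ and support size $|S|$. A DNF is normalized if every term is of the form $[\![S]\!]_\pi$ with $1\in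 S$ and all terms have the same support size (the support size of the DNF). -}

module Defs where

open import Data.Bool using (Bool; true; false; if_then_else_; _∧_; _∨_; not)
open import Data.Nat using (ℕ; zero; suc; _!; _⊔_; _∸_; _≤_)
open import Data.Nat.Properties using (_!≢0)
open import Data.Fin using (Fin; zero; suc; _≟_)
open import Data.List using (List; []; _∷_; map; concatMap; length; allFin; foldr)
open import Data.List.Membership.Propositional using (_∈_)
open import Data.List.Relation.Unary.All using (All)
open import Data.List.Relation.Unary.Unique.Propositional using (Unique)
open import Data.Product using (Σ; _×_)
open import Relation.Binary.PropositionalEquality using (_≡_)
open import Data.Integer using (ℤ; +_; _+_; _-_; _*_)
open import Data.Rational using (ℚ; _/_)
open import Relation.Nullary using (does)

-- Total orders on [n] (n = suc m, the element "1" of the paper is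
-- 'zero : Fin (suc m)').  A total order is represented by the list
-- of all elements in increasing order; Ord n is the list of all
-- permutations of [n] (each exactly once).

insertAll : {A : Set} → A → List A → List (List A)
insertAll a [] = (a ∷ []) ∷ []
insertAll a (b ∷ bs) = (a ∷ b ∷ bs) ∷ map (b ∷_) (insertAll a bs)

perms : {A : Set} → List A → List (List A)
perms [] = [] ∷ []
perms (a ∷ as) = concatMap (insertAll a) (perms as)

Ord : (n : ℕ) → List (List (Fin n))
Ord n = perms (allFin n)

elem : ∀ {n} → Fin n → List (Fin n) → Bool
elem i [] = false
elem i (k ∷ ks) = does (k ≟ i) ∨ elem i ks

-- value of the variable x_{i,j} at the total order xs:
-- true iff i precedes j in xs
prec : ∀ {n} → List (Fin n) → Fin n → Fin n → Bool
prec [] i j = false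
prec (k ∷ ks) i j =
  if does (k ≟ i) then elem j ks
  else (if does (k ≟ j) then false else prec ks i j)

data Lit (n : ℕ) : Set where
  pos : Fin n → Fin n → Lit n
  neg : Fin n → Fin n → Lit n

Term : ℕ → Set
Term n = List (Lit n)

DNF : ℕ → Set
DNF n = List (Term n)

litTrue : ∀ {n} → List (Fin n) → Lit n → Bool
litTrue x (pos i j) = prec x i j
litTrue x (neg i j) = not (prec x i j)

termTrue : ∀ {n} → List (Fin n) → Term n → Bool
termTrue x s = foldr (λ l b → litTrue x l ∧ b) true s

dnfTrue : ∀ {n} → List (Fin n) → DNF n → Bool
dnfTrue x D = foldr (λ s b → termTrue x s ∨ b) false D

b2z : Bool → ℤ
b2z true = + 1
b2z false = + 0

litVal : ∀ {n} → List (Fin n) → Lit n → ℤ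
litVal x (pos i j) = b2z (prec x i j)
litVal x (neg i j) = + 1 - b2z (prec x i j)

termVal : ∀ {n} → List (Fin n) → Term n → ℤ
termVal x s = foldr (λ l v → litVal x l * v) (+ 1) s

dnfVal : ∀ {n} → List (Fin n) → DNF n → ℤ
dnfVal x D = foldr (λ s v → termVal x s + v) (+ 0) D - + 1

-- pseudo-expectation: uniform average over all total orders,
-- |Ord| = n!
Ẽ : (n : ℕ) → (List (Fin n) → ℤ) → ℚ
Ẽ n p = (foldr (λ x v → p x + v) (+ 0) (Ord n) / (n !)) {{n !≢0}}

-- degree: terms of DNFs are products of literals on distinct variables
-- in all cases used here (chains of distinct elements); the degree of a
-- term is its number of literals, of a DNF the maximum over its terms.
termDeg : ∀ {n} → Term n → ℕ
termDeg s = length s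

dnfDeg : ∀ {n} → DNF n → ℕ
dnfDeg D = foldr (λ s d → termDeg s ⊔ d) 0 D

-- chain terms [[S]]_π = x_{π(1),π(2)} ... x_{π(|S|-1),π(|S|)},
-- π given as the list  π(1) ∷ ... ∷ π(|S|)

chain : ∀ {n} → List (Fin n) → Term n
chain [] = []
chain (a ∷ []) = []
chain (a ∷ b ∷ bs) = pos a b ∷ chain (b ∷ bs)

M1 : (m : ℕ) → DNF (suc m)
M1 m = map (λ j → pos (suc j) zero ∷ []) (allFin m)

IsNormTerm : ∀ {m} → ℕ → Term (suc m) → Set
IsNormTerm {m} h s =
  Σ (List (Fin (suc m))) λ p →
    Unique p × length p ≡ h × zero ∈ p × s ≡ chain p

Normalized : ∀ {m} → DNF (suc m) → ℕ → Set
Normalized D h = 2 ≤ h × All (IsNormTerm h) D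

{-# OPTIONS --safe #-}
module Submission where

-- Write N = ⋁ [[p]] over enumerations p, and t = [[q]]. For each p, pad p ∪ q with fresh
-- elements to a set W of exactly k = min(ℓ + h, n) elements, and replace [[p]] by the block of
-- chains [[W]]_τ over the enumerations τ of W along which both p and q are increasing. At a total
-- order x exactly one enumeration of W is x-increasing, and along it p and q are increasing iff
-- they are x-increasing; so the block has exactly [p(x) ∧ t(x)] true terms, and N' has
-- (#true terms of N) · t(x) of them. This gives N' ⇔ N ∧ t, and since the polynomial of a DNF is
-- its number of true terms minus one, (S − 1) t = (S t − 1) + 1 − t holds pointwise on Ord.
-- Exactly one enumeration is increasing because among the insertions of a new element into a
-- list σ, one is increasing if σ is and none otherwise.

open import Defs
open import Data.Bool using (Bool; true; false; _∧_; not; T?)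
open import Data.Nat using (ℕ; zero; suc; _+_; _∸_; _≤_; _*_; _⊓_; _<ᵇ_; z≤n; s≤s; _!)
open import Data.Nat.Properties
  using (+-identityʳ; *-identityʳ; *-zeroʳ; +-assoc; *-distribʳ-+; ≤-trans; ≤-reflexive; m⊓n≤n; m⊓n≤m; ⊓-glb;
         m≤n⇒m⊓n≡m; ⊔-lub; m≤m⊔n; m≤m+n; m≤n+m∸n; +-suc; +-comm; m+[n∸m]≡n; m+n∸m≡n; ∸-monoˡ-≤; +-monoʳ-≤; _!≢0; module ≤-Reasoning)
open import Data.Fin using (Fin; zero; suc; _≟_)
open import Data.List using (List; []; _∷_; _++_; length; map; concatMap; filter; filterᵇ; take; allFin; tabulate; foldr; lookup; removeAt; deduplicate)
open import Data.List.Properties using (length-++; length-take; length-removeAt′; length-tabulate; length-deduplicate; take++drop≡id)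
open import Data.List.Membership.Propositional using (_∈_; _∉_; find)
open import Data.List.Membership.Propositional.Properties using (∈-allFin; ∈-++⁺ˡ; ∈-++⁺ʳ; ∈-map⁻; ∈-map⁺; ∈-filter⁻; ∈-filter⁺; ∈-concatMap⁻; ∈-concatMap⁺; ∈-deduplicate⁺)
import Data.List.Membership.DecPropositional as DecMembership
open import Data.List.Relation.Binary.Subset.Propositional using (_⊆_)
open import Data.List.Relation.Binary.Permutation.Propositional using (_↭_; ↭-refl; ↭-prep; ↭-swap; ↭-trans; ↭-sym; ↭⇒↭ₛ)
open import Data.List.Relation.Binary.Permutation.Propositional.Properties using (↭-length; ∈-resp-↭)
import Data.List.Relation.Binary.Permutation.Setoid.Properties as Permutationₛ
open import Data.List.Relation.Unary.Any as Any using (here; there)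
open import Data.List.Relation.Unary.Any.Properties using (lookup-index)
open import Data.List.Relation.Unary.All as All using (All; []; _∷_)
import Data.List.Relation.Unary.All.Properties as AllP
open import Data.List.Relation.Unary.AllPairs using (_∷_)
open import Data.List.Relation.Unary.Unique.Propositional using (Unique)
open import Data.List.Relation.Unary.Unique.Propositional.Properties using (++⁺; take⁺; filter⁺; allFin⁺; Unique[x∷xs]⇒x∉xs)
import Data.List.Relation.Unary.Unique.DecPropositional.Properties as DecUnique
open import Data.Bool.Properties using (∧-zeroʳ)
open import Data.Product using (Σ; ∃-syntax; _×_; _,_; proj₁; proj₂)
open import Data.Empty using (⊥-elim)
open import Data.Integer using (ℤ; +_; _-_) renaming (_+_ to _+ℤ_; _*_ to _*ℤ_)
import Data.Integer.Properties as ℤP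
open import Data.Integer.Tactic.RingSolver using (solve-∀)
open import Data.Rational using (_/_)
open import Function using (_∘_)
open import Function.Bundles using (_⇔_; mk⇔)
open import Relation.Nullary using (¬_; yes; no)
open import Relation.Binary.PropositionalEquality using (setoid; _≡_; _≢_; refl; sym; trans; cong; cong₂; subst; module ≡-Reasoning)

private
  variable
    A : Set

∧≡true⇒ : ∀ {a b} → a ∧ b ≡ true → a ≡ true × b ≡ true
∧≡true⇒ {true} b≡true = refl , b≡true

∧-congˡ-when : ∀ {a b c} → (c ≡ true → a ≡ b) → a ∧ c ≡ b ∧ c
∧-congˡ-when {a} {b} {true} a≡b = cong (_∧ true) (a≡b refl)
∧-congˡ-when {a} {b} {false} _ = trans (∧-zeroʳ a) (sym (∧-zeroʳ b))

∧-monoˡ-true : ∀ {a b c} → (a ≡ true → b ≡ true) → a ∧ c ≡ true → b ∧ c ≡ true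
∧-monoˡ-true {true} a⇒b c≡true rewrite a⇒b refl = c≡true

𝟙 : Bool → ℕ
𝟙 true = 1
𝟙 false = 0

𝟙-∧ : ∀ a b → 𝟙 (a ∧ b) ≡ 𝟙 a * 𝟙 b
𝟙-∧ true b = sym (+-identityʳ (𝟙 b))
𝟙-∧ false b = refl

countᵇ : (A → Bool) → List A → ℕ
countᵇ f [] = 0
countᵇ f (a ∷ as) = 𝟙 (f a) + countᵇ f as

module _ {f : A → Bool} where
  countᵇ-++ : ∀ xs ys → countᵇ f (xs ++ ys) ≡ countᵇ f xs + countᵇ f ys
  countᵇ-++ [] ys = refl
  countᵇ-++ (x ∷ xs) ys = trans (cong (_+_ (𝟙 (f x))) (countᵇ-++ xs ys)) (sym (+-assoc (𝟙 (f x)) _ _))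

  countᵇ-map : ∀ {B : Set} (g : B → A) xs → countᵇ f (map g xs) ≡ countᵇ (f ∘ g) xs
  countᵇ-map g [] = refl
  countᵇ-map g (x ∷ xs) = cong (_+_ (𝟙 (f (g x)))) (countᵇ-map g xs)

  countᵇ-filterᵇ : ∀ (g : A → Bool) xs → countᵇ f (filterᵇ g xs) ≡ countᵇ (λ a → g a ∧ f a) xs
  countᵇ-filterᵇ g [] = refl
  countᵇ-filterᵇ g (x ∷ xs) with g x
  ... | true = cong (_+_ (𝟙 (f x))) (countᵇ-filterᵇ g xs)
  ... | false = countᵇ-filterᵇ g xs

  countᵇ-cong-∈ : ∀ {g : A → Bool} xs → (∀ {a} → a ∈ xs → f a ≡ g a) → countᵇ f xs ≡ countᵇ g xs
  countᵇ-cong-∈ [] f≗g = refl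
  countᵇ-cong-∈ (x ∷ xs) f≗g = cong₂ _+_ (cong 𝟙 (f≗g (here refl))) (countᵇ-cong-∈ xs (f≗g ∘ there))

  countᵇ-const-∧ : ∀ b xs → countᵇ (λ a → b ∧ f a) xs ≡ 𝟙 b * countᵇ f xs
  countᵇ-const-∧ true xs = sym (+-identityʳ (countᵇ f xs))
  countᵇ-const-∧ false [] = refl
  countᵇ-const-∧ false (x ∷ xs) = countᵇ-const-∧ false xs

∈-removeAt : ∀ {xs : List A} (i : Fin (length xs)) {y} → y ∈ xs → y ≢ lookup xs i → y ∈ removeAt xs i
∈-removeAt {xs = x ∷ xs} zero (here refl) y≢x = ⊥-elim (y≢x refl)
∈-removeAt {xs = x ∷ xs} zero (there y∈xs) _ = y∈xs
∈-removeAt {xs = x ∷ xs} (suc i) (here refl) _ = here refl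
∈-removeAt {xs = x ∷ xs} (suc i) (there y∈xs) y≢ = there (∈-removeAt i y∈xs y≢)

Unique-⊆⇒length≤ : ∀ {xs ys : List A} → Unique xs → xs ⊆ ys → length xs ≤ length ys
Unique-⊆⇒length≤ {xs = []} _ _ = z≤n
Unique-⊆⇒length≤ {xs = x ∷ xs} {ys} (x∉xs ∷ xs!) x∷xs⊆ys = begin
  suc (length xs)              ≤⟨ s≤s (Unique-⊆⇒length≤ xs! xs⊆ys-x) ⟩
  suc (length (removeAt ys i)) ≡⟨ length-removeAt′ ys i ⟨
  length ys                    ∎
  where
  open ≤-Reasoning
  i = Any.index (x∷xs⊆ys (here refl))
  xs⊆ys-x : xs ⊆ removeAt ys i
  xs⊆ys-x y∈xs = ∈-removeAt i (x∷xs⊆ys (there y∈xs))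
    (λ y≡ → All.lookup x∉xs y∈xs (trans (lookup-index (x∷xs⊆ys (here refl))) (sym y≡)))

module _ {n : ℕ} where
  open DecMembership (_≟_ {n}) using (_∈?_; _∉?_)

  length-allFin : length (allFin n) ≡ n
  length-allFin = length-tabulate (λ i → i)

  Unique⇒length≤ : {xs : List (Fin n)} → Unique xs → length xs ≤ n
  Unique⇒length≤ xs! = ≤-trans (Unique-⊆⇒length≤ xs! (λ {y} _ → ∈-allFin y)) (≤-reflexive length-allFin)

  fresh : List (Fin n) → List (Fin n)
  fresh xs = filter (_∉? xs) (allFin n)

  ⊆-++-fresh : ∀ xs → allFin n ⊆ xs ++ fresh xs
  ⊆-++-fresh xs {y} _ with y ∈? xs
  ... | yes y∈xs = ∈-++⁺ˡ y∈xs
  ... | no y∉xs = ∈-++⁺ʳ xs (∈-filter⁺ (_∉? xs) (∈-allFin y) y∉xs)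

  length-fresh : ∀ xs → n ∸ length xs ≤ length (fresh xs)
  length-fresh xs = begin
    n ∸ length xs                          ≤⟨ ∸-monoˡ-≤ (length xs) n≤ ⟩
    length (xs ++ fresh xs) ∸ length xs    ≡⟨ cong (_∸ length xs) (length-++ xs) ⟩
    length xs + length (fresh xs) ∸ length xs ≡⟨ m+n∸m≡n (length xs) (length (fresh xs)) ⟩
    length (fresh xs)                      ∎
    where
    open ≤-Reasoning
    n≤ : n ≤ length (xs ++ fresh xs)
    n≤ = ≤-trans (≤-reflexive (sym length-allFin)) (Unique-⊆⇒length≤ (allFin⁺ n) (⊆-++-fresh xs))

  extendTo : ℕ → List (Fin n) → List (Fin n)
  extendTo k xs = xs ++ take (k ∸ length xs) (fresh xs)

  module _ (k : ℕ) (xs : List (Fin n)) where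
    ⊆-extendTo : xs ⊆ extendTo k xs
    ⊆-extendTo = ∈-++⁺ˡ

    extendTo-unique : Unique xs → Unique (extendTo k xs)
    extendTo-unique xs! = ++⁺ xs! (take⁺ (k ∸ length xs) (filter⁺ (_∉? xs) {allFin n} (allFin⁺ n))) disjoint
      where
      disjoint : ∀ {y} → ¬ (y ∈ xs × y ∈ take (k ∸ length xs) (fresh xs))
      disjoint (y∈xs , y∈take) =
        proj₂ (∈-filter⁻ (_∉? xs) {xs = allFin n} (subst (_ ∈_) (take++drop≡id (k ∸ length xs) (fresh xs)) (∈-++⁺ˡ y∈take))) y∈xs

    extendTo-length : length xs ≤ k → k ≤ n → length (extendTo k xs) ≡ k
    extendTo-length xs≤k k≤n = begin
      length (extendTo k xs)                               ≡⟨ length-++ xs ⟩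
      length xs + length (take (k ∸ length xs) (fresh xs)) ≡⟨ cong (_+_ (length xs)) (length-take (k ∸ length xs) (fresh xs)) ⟩
      length xs + (k ∸ length xs) ⊓ length (fresh xs)     ≡⟨ cong (_+_ (length xs)) (m≤n⇒m⊓n≡m enough-fresh) ⟩
      length xs + (k ∸ length xs)                          ≡⟨ m+[n∸m]≡n xs≤k ⟩
      k                                                    ∎
      where
      open ≡-Reasoning
      enough-fresh : k ∸ length xs ≤ length (fresh xs)
      enough-fresh = ≤-trans (∸-monoˡ-≤ (length xs) k≤n) (length-fresh xs)

insertAll-↭ : ∀ (a : A) σ {τ} → τ ∈ insertAll a σ → τ ↭ a ∷ σ
insertAll-↭ a [] (here refl) = ↭-refl
insertAll-↭ a (b ∷ σ) (here refl) = ↭-refl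
insertAll-↭ a (b ∷ σ) (there τ∈) with ∈-map⁻ (b ∷_) τ∈
... | τ′ , τ′∈ , refl = ↭-trans (↭-prep b (insertAll-↭ a σ τ′∈)) (↭-swap b a ↭-refl)

perms-↭ : ∀ (ws : List A) {τ} → τ ∈ perms ws → τ ↭ ws
perms-↭ [] (here refl) = ↭-refl
perms-↭ (a ∷ ws) τ∈ with find (∈-concatMap⁻ (insertAll a) {xs = perms ws} τ∈)
... | σ , σ∈ , τ∈σ = ↭-trans (insertAll-↭ a σ τ∈σ) (↭-prep a (perms-↭ ws σ∈))

perms-unique : ∀ {ws : List A} {τ} → τ ∈ perms ws → Unique ws → Unique τ
perms-unique {A = A} {ws} τ∈ = Permutationₛ.Unique-resp-↭ (setoid A) (↭⇒↭ₛ (↭-sym (perms-↭ ws τ∈)))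

∷∈insertAll : ∀ (a : A) σ → a ∷ σ ∈ insertAll a σ
∷∈insertAll a [] = here refl
∷∈insertAll a (_ ∷ _) = here refl

∈-perms-self : ∀ (ws : List A) → ws ∈ perms ws
∈-perms-self [] = here refl
∈-perms-self (a ∷ ws) = ∈-concatMap⁺ (insertAll a) (Any.map (λ { refl → ∷∈insertAll a ws }) (∈-perms-self ws))

swap∈perms : ∀ (a b : A) ws → b ∷ a ∷ ws ∈ perms (a ∷ b ∷ ws)
swap∈perms a b ws = ∈-concatMap⁺ (insertAll a) (Any.map (λ { refl → there (∈-map⁺ (b ∷_) (∷∈insertAll a ws)) }) (∈-perms-self (b ∷ ws)))

-- Inserting a into b ∷ σ behind c: either a lands in front of b (first summand) or inside σ (second).
insertion-split : ∀ ca ab cb C → (ca ≡ true → ab ≡ true → cb ≡ true) → (cb ≡ true → ab ≡ false → ca ≡ true) →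
  𝟙 (ca ∧ (ab ∧ C)) + 𝟙 cb * 𝟙 (not ab ∧ C) ≡ 𝟙 (ca ∧ (cb ∧ C))
insertion-split true  true  true  C _ _ = +-identityʳ _
insertion-split true  true  false C t _ with () ← t refl refl
insertion-split true  false true  C _ _ = +-identityʳ _
insertion-split true  false false C _ _ = refl
insertion-split false true  cb    C _ _ = *-zeroʳ (𝟙 cb)
insertion-split false false true  C _ t with () ← t refl refl
insertion-split false false false C _ _ = refl

𝟙-split : ∀ u C → 𝟙 (u ∧ C) + 𝟙 (not u ∧ C) ≡ 𝟙 C
𝟙-split true C = +-identityʳ (𝟙 C)
𝟙-split false C = refl

module _ {n : ℕ} where
  elem⇒∈ : ∀ {i : Fin n} ks → elem i ks ≡ true → i ∈ ks
  elem⇒∈ {i} (k ∷ ks) e with k ≟ i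
  ... | yes refl = here refl
  ... | no _ = there (elem⇒∈ ks e)

  ∈⇒elem : ∀ {i : Fin n} {ks} → i ∈ ks → elem i ks ≡ true
  ∈⇒elem {i} {k ∷ ks} i∈ with k ≟ i | i∈
  ... | yes _ | _ = refl
  ... | no k≢i | here refl = ⊥-elim (k≢i refl)
  ... | no _ | there i∈ks = ∈⇒elem i∈ks

  ∉⇒elem : ∀ {i : Fin n} ks → i ∉ ks → elem i ks ≡ false
  ∉⇒elem {i} ks i∉ with elem i ks in e
  ... | true = ⊥-elim (i∉ (elem⇒∈ ks e))
  ... | false = refl

  ∈-tail : ∀ {k y : Fin n} {ks} → y ∈ k ∷ ks → k ≢ y → y ∈ ks
  ∈-tail (here refl) k≢y = ⊥-elim (k≢y refl)
  ∈-tail (there y∈ks) _ = y∈ks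

  prec⇒∈ : ∀ (x : List (Fin n)) {i j} → prec x i j ≡ true → j ∈ x
  prec⇒∈ (k ∷ ks) {i} {j} e with k ≟ i
  ... | yes _ = there (elem⇒∈ ks e)
  ... | no _ with k ≟ j
  ...   | no _ = there (prec⇒∈ ks e)

  prec-irrefl : ∀ x {i} → Unique x → prec x i i ≡ false
  prec-irrefl [] _ = refl
  prec-irrefl (k ∷ ks) {i} k∷ks!@(_ ∷ ks!) with k ≟ i
  ... | yes refl = ∉⇒elem ks (Unique[x∷xs]⇒x∉xs k∷ks!)
  ... | no _ = prec-irrefl ks ks!

  prec-trans : ∀ x {i j l} → Unique x → prec x i j ≡ true → prec x j l ≡ true → prec x i l ≡ true
  prec-trans (k ∷ ks) {i} {j} {l} k∷ks!@(_ ∷ ks!) i≺j j≺l with k ≟ i | k ≟ j | k ≟ l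
  ... | yes refl | yes refl | _ = ⊥-elim (Unique[x∷xs]⇒x∉xs k∷ks! (elem⇒∈ ks i≺j))
  ... | yes refl | no _ | no _ = ∈⇒elem (prec⇒∈ ks j≺l)
  ... | no _ | no _ | no _ = prec-trans ks ks! i≺j j≺l

  prec-flip : ∀ x {i j} → Unique x → i ≢ j → i ∈ x → j ∈ x → prec x j i ≡ not (prec x i j)
  prec-flip (k ∷ ks) {i} {j} k∷ks!@(_ ∷ ks!) i≢j i∈ j∈ with k ≟ i | k ≟ j
  ... | yes refl | yes refl = ⊥-elim (i≢j refl)
  ... | yes refl | no k≢j = cong not (sym (∈⇒elem (∈-tail j∈ k≢j)))
  ... | no k≢i | yes refl = ∈⇒elem (∈-tail i∈ k≢i)
  ... | no k≢i | no k≢j = prec-flip ks ks! i≢j (∈-tail i∈ k≢i) (∈-tail j∈ k≢j)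

  increasing : List (Fin n) → List (Fin n) → Bool
  increasing x τ = termTrue x (chain τ)

  module TotalOrder (x : List (Fin n)) (x! : Unique x) (x-complete : ∀ i → i ∈ x) where
    infix 7 _≺_
    _≺_ : Fin n → Fin n → Bool
    i ≺ j = prec x i j

    ≺-flip : ∀ {i j} → i ≢ j → j ≺ i ≡ not (i ≺ j)
    ≺-flip i≢j = prec-flip x x! i≢j (x-complete _) (x-complete _)

    ≺-trans : ∀ {i j l} → i ≺ j ≡ true → j ≺ l ≡ true → i ≺ l ≡ true
    ≺-trans = prec-trans x x!

    countᵇ-prepend : ∀ c b τs →
      countᵇ (increasing x ∘ (c ∷_)) (map (b ∷_) τs) ≡ 𝟙 (c ≺ b) * countᵇ (increasing x ∘ (b ∷_)) τs
    countᵇ-prepend c b τs = trans (countᵇ-map (b ∷_) τs) (countᵇ-const-∧ (c ≺ b) τs)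

    countᵇ-insertAll-after : ∀ c a σ → a ≢ c → a ∉ σ →
      countᵇ (increasing x ∘ (c ∷_)) (insertAll a σ) ≡ 𝟙 (c ≺ a ∧ increasing x (c ∷ σ))
    countᵇ-insertAll-after c a [] _ _ = +-identityʳ _
    countᵇ-insertAll-after c a (b ∷ σ) a≢c a∉b∷σ = begin
      𝟙 (c ≺ a ∧ (a ≺ b ∧ C)) + countᵇ (increasing x ∘ (c ∷_)) (map (b ∷_) (insertAll a σ))
        ≡⟨ cong (_+_ (𝟙 (c ≺ a ∧ (a ≺ b ∧ C)))) (countᵇ-prepend c b (insertAll a σ)) ⟩
      𝟙 (c ≺ a ∧ (a ≺ b ∧ C)) + 𝟙 (c ≺ b) * countᵇ (increasing x ∘ (b ∷_)) (insertAll a σ)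
        ≡⟨ cong (λ v → 𝟙 (c ≺ a ∧ (a ≺ b ∧ C)) + 𝟙 (c ≺ b) * v) (countᵇ-insertAll-after b a σ a≢b (a∉b∷σ ∘ there)) ⟩
      𝟙 (c ≺ a ∧ (a ≺ b ∧ C)) + 𝟙 (c ≺ b) * 𝟙 (b ≺ a ∧ C)
        ≡⟨ cong (λ u → 𝟙 (c ≺ a ∧ (a ≺ b ∧ C)) + 𝟙 (c ≺ b) * 𝟙 (u ∧ C)) (≺-flip a≢b) ⟩
      𝟙 (c ≺ a ∧ (a ≺ b ∧ C)) + 𝟙 (c ≺ b) * 𝟙 (not (a ≺ b) ∧ C)
        ≡⟨ insertion-split (c ≺ a) (a ≺ b) (c ≺ b) C ≺-trans (λ c≺b b≺a → ≺-trans c≺b (trans (≺-flip a≢b) (cong not b≺a))) ⟩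
      𝟙 (c ≺ a ∧ (c ≺ b ∧ C)) ∎
      where
      open ≡-Reasoning
      C = increasing x (b ∷ σ)
      a≢b : a ≢ b
      a≢b = a∉b∷σ ∘ here

    countᵇ-insertAll : ∀ a σ → a ∉ σ → countᵇ (increasing x) (insertAll a σ) ≡ 𝟙 (increasing x σ)
    countᵇ-insertAll a [] _ = refl
    countᵇ-insertAll a (b ∷ σ) a∉b∷σ = begin
      𝟙 (a ≺ b ∧ C) + countᵇ (increasing x) (map (b ∷_) (insertAll a σ))
        ≡⟨ cong (_+_ (𝟙 (a ≺ b ∧ C))) (countᵇ-map (b ∷_) (insertAll a σ)) ⟩
      𝟙 (a ≺ b ∧ C) + countᵇ (increasing x ∘ (b ∷_)) (insertAll a σ)
        ≡⟨ cong (_+_ (𝟙 (a ≺ b ∧ C))) (countᵇ-insertAll-after b a σ a≢b (a∉b∷σ ∘ there)) ⟩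
      𝟙 (a ≺ b ∧ C) + 𝟙 (b ≺ a ∧ C)
        ≡⟨ cong (λ u → 𝟙 (a ≺ b ∧ C) + 𝟙 (u ∧ C)) (≺-flip a≢b) ⟩
      𝟙 (a ≺ b ∧ C) + 𝟙 (not (a ≺ b) ∧ C)
        ≡⟨ 𝟙-split (a ≺ b) C ⟩
      𝟙 C ∎
      where
      open ≡-Reasoning
      C = increasing x (b ∷ σ)
      a≢b : a ≢ b
      a≢b = a∉b∷σ ∘ here

    countᵇ-perms : ∀ ws → Unique ws → countᵇ (increasing x) (perms ws) ≡ 1
    countᵇ-perms [] _ = refl
    countᵇ-perms (a ∷ ws) a∷ws!@(_ ∷ ws!) =
      trans (countᵇ-concatMap-insertAll (perms ws) (λ σ∈ a∈σ → a∉ws (∈-resp-↭ (perms-↭ ws σ∈) a∈σ)))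
            (countᵇ-perms ws ws!)
      where
      a∉ws = Unique[x∷xs]⇒x∉xs a∷ws!
      countᵇ-concatMap-insertAll : ∀ σs → (∀ {σ} → σ ∈ σs → a ∉ σ) →
        countᵇ (increasing x) (concatMap (insertAll a) σs) ≡ countᵇ (increasing x) σs
      countᵇ-concatMap-insertAll [] _ = refl
      countᵇ-concatMap-insertAll (σ ∷ σs) a∉ = begin
        countᵇ (increasing x) (insertAll a σ ++ concatMap (insertAll a) σs)
          ≡⟨ countᵇ-++ (insertAll a σ) _ ⟩
        countᵇ (increasing x) (insertAll a σ) + countᵇ (increasing x) (concatMap (insertAll a) σs)
          ≡⟨ cong₂ _+_ (countᵇ-insertAll a σ (a∉ (here refl))) (countᵇ-concatMap-insertAll σs (a∉ ∘ there)) ⟩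
        𝟙 (increasing x σ) + countᵇ (increasing x) σs ∎
        where open ≡-Reasoning

    increasing-tail : ∀ k ks → increasing x (k ∷ ks) ≡ true → increasing x ks ≡ true
    increasing-tail k [] _ = refl
    increasing-tail k (b ∷ bs) inc = proj₂ (∧≡true⇒ inc)

    increasing⇒head≺ : ∀ k ks {y} → increasing x (k ∷ ks) ≡ true → y ∈ ks → k ≺ y ≡ true
    increasing⇒head≺ k (b ∷ bs) inc (here refl) = proj₁ (∧≡true⇒ inc)
    increasing⇒head≺ k (b ∷ bs) inc (there y∈bs) =
      ≺-trans (proj₁ (∧≡true⇒ inc)) (increasing⇒head≺ b bs (proj₂ (∧≡true⇒ inc)) y∈bs)

    prec-increasing : ∀ τ {i j} → Unique τ → increasing x τ ≡ true → i ∈ τ → j ∈ τ → prec τ i j ≡ i ≺ j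
    prec-increasing (k ∷ ks) {i} {j} k∷ks!@(_ ∷ ks!) inc i∈ j∈ with k ≟ i | k ≟ j
    ... | yes refl | yes refl = trans (∉⇒elem ks (Unique[x∷xs]⇒x∉xs k∷ks!)) (sym (prec-irrefl x x!))
    ... | yes refl | no k≢j = trans (∈⇒elem (∈-tail j∈ k≢j)) (sym (increasing⇒head≺ k ks inc (∈-tail j∈ k≢j)))
    ... | no k≢i | yes refl = sym (trans (≺-flip k≢i) (cong not (increasing⇒head≺ k ks inc (∈-tail i∈ k≢i))))
    ... | no k≢i | no k≢j = prec-increasing ks ks! (increasing-tail k ks inc) (∈-tail i∈ k≢i) (∈-tail j∈ k≢j)

    increasing-restrict : ∀ τ ps → Unique τ → increasing x τ ≡ true → ps ⊆ τ → increasing τ ps ≡ increasing x ps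
    increasing-restrict τ [] _ _ _ = refl
    increasing-restrict τ (a ∷ []) _ _ _ = refl
    increasing-restrict τ (a ∷ b ∷ bs) τ! inc ps⊆τ =
      cong₂ _∧_ (prec-increasing τ τ! inc (ps⊆τ (here refl)) (ps⊆τ (there (here refl))))
                (increasing-restrict τ (b ∷ bs) τ! inc (ps⊆τ ∘ there))

  b2z≡𝟙 : ∀ b → b2z b ≡ + 𝟙 b
  b2z≡𝟙 true = refl
  b2z≡𝟙 false = refl

  termVal≡𝟙 : ∀ (x : List (Fin n)) s → termVal x s ≡ + 𝟙 (termTrue x s)
  termVal≡𝟙 x [] = refl
  termVal≡𝟙 x (l ∷ s) = begin
    litVal x l *ℤ termVal x s                   ≡⟨ cong₂ _*ℤ_ (litVal≡𝟙 l) (termVal≡𝟙 x s) ⟩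
    + 𝟙 (litTrue x l) *ℤ + 𝟙 (termTrue x s)     ≡⟨ ℤP.pos-* (𝟙 (litTrue x l)) (𝟙 (termTrue x s)) ⟨
    + (𝟙 (litTrue x l) * 𝟙 (termTrue x s))       ≡⟨ cong +_ (𝟙-∧ (litTrue x l) (termTrue x s)) ⟨
    + 𝟙 (litTrue x l ∧ termTrue x s)             ∎
    where
    open ≡-Reasoning
    litVal≡𝟙 : ∀ l → litVal x l ≡ + 𝟙 (litTrue x l)
    litVal≡𝟙 (pos i j) = b2z≡𝟙 (prec x i j)
    litVal≡𝟙 (neg i j) with prec x i j
    ... | true = refl
    ... | false = refl

  dnfVal≡count : ∀ (x : List (Fin n)) D → dnfVal x D ≡ + countᵇ (termTrue x) D - + 1
  dnfVal≡count x D = cong (_- + 1) (sum≡count D)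
    where
    sum≡count : ∀ D → foldr (λ s v → termVal x s +ℤ v) (+ 0) D ≡ + countᵇ (termTrue x) D
    sum≡count [] = refl
    sum≡count (s ∷ D) = trans (cong₂ _+ℤ_ (termVal≡𝟙 x s) (sum≡count D)) (sym (ℤP.pos-+ (𝟙 (termTrue x s)) (countᵇ (termTrue x) D)))

  dnfTrue≡0<count : ∀ (x : List (Fin n)) D → dnfTrue x D ≡ (0 <ᵇ countᵇ (termTrue x) D)
  dnfTrue≡0<count x [] = refl
  dnfTrue≡0<count x (s ∷ D) with termTrue x s
  ... | true = refl
  ... | false = dnfTrue≡0<count x D

0<ᵇ*𝟙 : ∀ c t → (0 <ᵇ c * 𝟙 t) ≡ (0 <ᵇ c) ∧ t
0<ᵇ*𝟙 zero t = refl
0<ᵇ*𝟙 (suc c) true = refl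
0<ᵇ*𝟙 (suc c) false = cong (0 <ᵇ_) (*-zeroʳ c)

[c-1]t≡[ct-1]+1-t : ∀ c t → (+ c - + 1) *ℤ + t ≡ ((+ (c * t) - + 1) +ℤ + 1) - + t
[c-1]t≡[ct-1]+1-t c t = trans (ring (+ c) (+ t)) (cong (λ z → (z - + 1 +ℤ + 1) - + t) (sym (ℤP.pos-* c t)))
  where
  ring : ∀ a b → (a - + 1) *ℤ b ≡ ((a *ℤ b - + 1) +ℤ + 1) - b
  ring = solve-∀

Ẽ-cong : ∀ n {f g : List (Fin n) → ℤ} → (∀ x → x ∈ Ord n → f x ≡ g x) → Ẽ n f ≡ Ẽ n g
Ẽ-cong n f≗g = cong (λ z → (z / n !) {{n !≢0}}) (sum-cong (Ord n) (λ x∈ → f≗g _ x∈))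
  where
  sum-cong : ∀ {f g : List (Fin n) → ℤ} xs → (∀ {x} → x ∈ xs → f x ≡ g x) →
    foldr (λ x v → f x +ℤ v) (+ 0) xs ≡ foldr (λ x v → g x +ℤ v) (+ 0) xs
  sum-cong [] _ = refl
  sum-cong (x ∷ xs) f≗g = cong₂ _+ℤ_ (f≗g (here refl)) (sum-cong xs (f≗g ∘ there))

Ord-unique : ∀ {n} {x : List (Fin n)} → x ∈ Ord n → Unique x
Ord-unique {n} x∈Ord = perms-unique x∈Ord (allFin⁺ n)

Ord-complete : ∀ {n} {x : List (Fin n)} → x ∈ Ord n → ∀ i → i ∈ x
Ord-complete {n} x∈Ord i = ∈-resp-↭ (↭-sym (perms-↭ (allFin n) x∈Ord)) (∈-allFin i)

module Conjunction {m : ℕ} (q : List (Fin (suc m))) (h : ℕ) where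
  k : ℕ
  k = (length q + h) ⊓ suc m

  union : List (Fin (suc m)) → List (Fin (suc m))
  union p = deduplicate _≟_ (q ++ p)

  support : List (Fin (suc m)) → List (Fin (suc m))
  support p = extendTo k (union p)

  consistent : List (Fin (suc m)) → List (Fin (suc m)) → Bool
  consistent p τ = increasing τ p ∧ increasing τ q

  block : List (Fin (suc m)) → DNF (suc m)
  block p = map chain (filterᵇ (consistent p) (perms (support p)))

  conjoin : List (List (Fin (suc m))) → DNF (suc m)
  conjoin = concatMap block

  module _ (p : List (Fin (suc m))) where
    support-unique : Unique (support p)
    support-unique = extendTo-unique k (union p) (DecUnique.deduplicate-! _≟_ (q ++ p))

    ⊆-support : ∀ {y} → y ∈ q ++ p → y ∈ support p
    ⊆-support y∈ = ⊆-extendTo k (union p) (∈-deduplicate⁺ _≟_ y∈)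

    support-length : length p ≡ h → length (support p) ≡ k
    support-length refl = extendTo-length k (union p) (⊓-glb union≤ (Unique⇒length≤ (DecUnique.deduplicate-! _≟_ (q ++ p)))) (m⊓n≤n _ _)
      where
      union≤ : length (union p) ≤ length q + length p
      union≤ = ≤-trans (length-deduplicate _≟_ (q ++ p)) (≤-reflexive (length-++ q))

    perms-support : ∀ {τ} → τ ∈ perms (support p) → q ++ p ⊆ τ
    perms-support τ∈ = ∈-resp-↭ (↭-sym (perms-↭ (support p) τ∈)) ∘ ⊆-support

  module _ {x : List (Fin (suc m))} (x∈Ord : x ∈ Ord (suc m)) where
    open TotalOrder x (Ord-unique x∈Ord) (Ord-complete x∈Ord)

    countᵇ-block : ∀ p → countᵇ (termTrue x) (block p) ≡ 𝟙 (increasing x p ∧ increasing x q)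
    countᵇ-block p = begin
      countᵇ (termTrue x) (map chain (filterᵇ (consistent p) (perms W)))
        ≡⟨ countᵇ-map chain (filterᵇ (consistent p) (perms W)) ⟩
      countᵇ (increasing x) (filterᵇ (consistent p) (perms W))
        ≡⟨ countᵇ-filterᵇ (consistent p) (perms W) ⟩
      countᵇ (λ τ → consistent p τ ∧ increasing x τ) (perms W)
        ≡⟨ countᵇ-cong-∈ (perms W) (λ τ∈ → ∧-congˡ-when (consistent-restrict τ∈)) ⟩
      countᵇ (λ τ → t ∧ increasing x τ) (perms W)
        ≡⟨ countᵇ-const-∧ t (perms W) ⟩
      𝟙 t * countᵇ (increasing x) (perms W)
        ≡⟨ cong (_*_ (𝟙 t)) (countᵇ-perms W (support-unique p)) ⟩
      𝟙 t * 1
        ≡⟨ *-identityʳ (𝟙 t) ⟩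
      𝟙 t ∎
      where
      open ≡-Reasoning
      W = support p
      t = increasing x p ∧ increasing x q
      consistent-restrict : ∀ {τ} → τ ∈ perms W → increasing x τ ≡ true → consistent p τ ≡ t
      consistent-restrict τ∈ inc =
        cong₂ _∧_ (increasing-restrict _ p τ! inc (perms-support p τ∈ ∘ ∈-++⁺ʳ q))
                  (increasing-restrict _ q τ! inc (perms-support p τ∈ ∘ ∈-++⁺ˡ))
        where τ! = perms-unique τ∈ (support-unique p)

    countᵇ-conjoin : ∀ Ps → countᵇ (termTrue x) (conjoin Ps) ≡ countᵇ (increasing x) Ps * 𝟙 (increasing x q)
    countᵇ-conjoin [] = refl
    countᵇ-conjoin (p ∷ Ps) = begin
      countᵇ (termTrue x) (block p ++ conjoin Ps)
        ≡⟨ countᵇ-++ (block p) (conjoin Ps) ⟩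
      countᵇ (termTrue x) (block p) + countᵇ (termTrue x) (conjoin Ps)
        ≡⟨ cong₂ _+_ (trans (countᵇ-block p) (𝟙-∧ (increasing x p) (increasing x q))) (countᵇ-conjoin Ps) ⟩
      𝟙 (increasing x p) * 𝟙 (increasing x q) + countᵇ (increasing x) Ps * 𝟙 (increasing x q)
        ≡⟨ *-distribʳ-+ (𝟙 (increasing x q)) (𝟙 (increasing x p)) (countᵇ (increasing x) Ps) ⟨
      (𝟙 (increasing x p) + countᵇ (increasing x) Ps) * 𝟙 (increasing x q) ∎
      where open ≡-Reasoning

    conjoin-true : ∀ Ps → dnfTrue x (conjoin Ps) ≡ dnfTrue x (map chain Ps) ∧ increasing x q
    conjoin-true Ps = begin
      dnfTrue x (conjoin Ps)                                     ≡⟨ dnfTrue≡0<count x (conjoin Ps) ⟩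
      0 <ᵇ countᵇ (termTrue x) (conjoin Ps)                      ≡⟨ cong (0 <ᵇ_) (countᵇ-conjoin Ps) ⟩
      0 <ᵇ countᵇ (increasing x) Ps * 𝟙 (increasing x q)     ≡⟨ 0<ᵇ*𝟙 (countᵇ (increasing x) Ps) (increasing x q) ⟩
      (0 <ᵇ countᵇ (increasing x) Ps) ∧ increasing x q        ≡⟨ cong (λ c → (0 <ᵇ c) ∧ increasing x q) (countᵇ-map chain Ps) ⟨
      (0 <ᵇ countᵇ (termTrue x) (map chain Ps)) ∧ increasing x q ≡⟨ cong (_∧ increasing x q) (dnfTrue≡0<count x (map chain Ps)) ⟨
      dnfTrue x (map chain Ps) ∧ increasing x q               ∎
      where open ≡-Reasoning

    conjoin-value : ∀ Ps → dnfVal x (map chain Ps) *ℤ termVal x (chain q) ≡ (dnfVal x (conjoin Ps) +ℤ + 1) - termVal x (chain q)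
    conjoin-value Ps = begin
      dnfVal x (map chain Ps) *ℤ termVal x (chain q)
        ≡⟨ cong₂ _*ℤ_ (trans (dnfVal≡count x (map chain Ps)) (cong (λ c → + c - + 1) (countᵇ-map chain Ps))) (termVal≡𝟙 x (chain q)) ⟩
      (+ c - + 1) *ℤ + 𝟙 t
        ≡⟨ [c-1]t≡[ct-1]+1-t c (𝟙 t) ⟩
      ((+ (c * 𝟙 t) - + 1) +ℤ + 1) - + 𝟙 t
        ≡⟨ cong₂ (λ v u → (v +ℤ + 1) - u) (trans (dnfVal≡count x (conjoin Ps)) (cong (λ c → + c - + 1) (countᵇ-conjoin Ps))) (termVal≡𝟙 x (chain q)) ⟨
      (dnfVal x (conjoin Ps) +ℤ + 1) - termVal x (chain q) ∎
      where
      open ≡-Reasoning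
      c = countᵇ (increasing x) Ps
      t = increasing x q

  conjoin-normalized : zero ∈ q → ∀ {Ps} → All (λ p → length p ≡ h) Ps → All (IsNormTerm k) (conjoin Ps)
  conjoin-normalized 0∈q [] = []
  conjoin-normalized 0∈q {p ∷ Ps} (|p|≡h ∷ |Ps|≡h) = AllP.++⁺ (All.tabulate block-normal) (conjoin-normalized 0∈q |Ps|≡h)
    where
    block-normal : ∀ {s} → s ∈ block p → IsNormTerm k s
    block-normal s∈ with ∈-map⁻ chain s∈
    ... | τ , τ∈ , refl with proj₁ (∈-filter⁻ (T? ∘ consistent p) τ∈)
    ...   | τ∈perms =
      τ , perms-unique τ∈perms (support-unique p) ,
      trans (↭-length (perms-↭ (support p) τ∈perms)) (support-length p |p|≡h) ,
      perms-support p τ∈perms (∈-++⁺ˡ 0∈q) , refl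

length-chain : ∀ {n} (τ : List (Fin n)) → length (chain τ) ≡ length τ ∸ 1
length-chain [] = refl
length-chain (a ∷ []) = refl
length-chain (a ∷ b ∷ bs) = cong suc (length-chain (b ∷ bs))

dnfDeg-normalized : ∀ {m k} {D : DNF (suc m)} → All (IsNormTerm k) D → dnfDeg D ≤ k ∸ 1
dnfDeg-normalized [] = z≤n
dnfDeg-normalized ((τ , _ , refl , _ , refl) ∷ D-normal) =
  ⊔-lub (≤-reflexive (length-chain τ)) (dnfDeg-normalized D-normal)

M1-satisfiable : ∀ m → ∃[ x ] x ∈ Ord (suc (suc m)) × dnfTrue x (M1 (suc m)) ≡ true
M1-satisfiable m = _ , swap∈perms zero (suc zero) (tabulate (λ i → suc (suc i))) , refl

M1-weakening-degree : ∀ {m h} {D : DNF (suc m)} → 2 ≤ suc m → All (IsNormTerm h) D →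
  (∀ x → x ∈ Ord (suc m) → dnfTrue x (M1 m) ≡ true → dnfTrue x D ≡ true) → h ∸ 1 ≤ dnfDeg D
M1-weakening-degree {zero} (s≤s ()) _ _
M1-weakening-degree {suc m} {D = []} _ _ M1⇒D with x , x∈Ord , M1x ← M1-satisfiable m with () ← M1⇒D x x∈Ord M1x
M1-weakening-degree {suc m} {D = _ ∷ _} _ ((τ , _ , refl , _ , refl) ∷ _) _ = ≤-trans (≤-reflexive (sym (length-chain τ))) (m≤m⊔n _ _)

length+h∸1≤deg+termDeg+1 : ∀ {n h d} (q : List (Fin n)) → h ∸ 1 ≤ d → length q + h ∸ 1 ≤ d + termDeg (chain q) + 1
length+h∸1≤deg+termDeg+1 {h = h} {d} [] h∸1≤d = ≤-trans h∸1≤d (≤-trans (m≤m+n d 0) (m≤m+n (d + 0) 1))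
length+h∸1≤deg+termDeg+1 {h = h} {d} (a ∷ rest) h∸1≤d = begin
  length rest + h                       ≤⟨ +-monoʳ-≤ (length rest) (≤-trans (m≤n+m∸n h 1) (s≤s h∸1≤d)) ⟩
  length rest + suc d                   ≡⟨ +-suc (length rest) d ⟩
  suc (length rest + d)                 ≡⟨ cong suc (+-comm (length rest) d) ⟩
  suc (d + length rest)                 ≡⟨ +-comm (d + length rest) 1 ⟨
  d + length rest + 1                   ≡⟨ cong (λ e → d + e + 1) (length-chain (a ∷ rest)) ⟨
  d + termDeg (chain (a ∷ rest)) + 1    ∎
  where open ≤-Reasoning

normalized⇒chains : ∀ {m h} {N : DNF (suc m)} → All (IsNormTerm h) N → ∃[ Ps ] N ≡ map chain Ps × All (λ p → length p ≡ h) Ps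
normalized⇒chains [] = [] , refl , []
normalized⇒chains ((p , _ , |p|≡h , _ , refl) ∷ N-normal) with Ps , refl , |Ps|≡h ← normalized⇒chains N-normal =
  p ∷ Ps , refl , |p|≡h ∷ |Ps|≡h

lemma4p12 : (m : ℕ) (rest : List (Fin (suc m))) (ℓ h : ℕ) (N : DNF (suc m)) →
    Unique (zero ∷ rest) → length (zero ∷ rest) ≡ ℓ → 2 ≤ ℓ →
    Normalized N h →
    (∀ x → x ∈ Ord (suc m) → dnfTrue x (M1 m) ≡ true → dnfTrue x N ≡ true) →
    Σ (DNF (suc m)) λ N' →
      (∀ x → x ∈ Ord (suc m) →
        (dnfTrue x N' ≡ true) ⇔ ((dnfTrue x N ∧ termTrue x (chain (zero ∷ rest))) ≡ true))
      × (∀ x → x ∈ Ord (suc m) →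
        (dnfTrue x (M1 m) ∧ termTrue x (chain (zero ∷ rest))) ≡ true → dnfTrue x N' ≡ true)
      × (Σ ℕ λ h' → h' ≤ ℓ + h × Normalized N' h')
      × dnfDeg N' ≤ ℓ + h ∸ 1
      × ℓ + h ∸ 1 ≤ dnfDeg N + termDeg (chain (zero ∷ rest)) + 1
      × Ẽ (suc m) (λ x → dnfVal x N *ℤ termVal x (chain (zero ∷ rest)))
        ≡ Ẽ (suc m) (λ x → (dnfVal x N' +ℤ + 1) - termVal x (chain (zero ∷ rest)))
lemma4p12 m rest ℓ h N q! refl 2≤ℓ (_ , N-normal) M1⇒N with Ps , refl , |Ps|≡h ← normalized⇒chains N-normal =
  conjoin Ps ,
  (λ x x∈Ord → mk⇔ (subst (_≡ true) (conjoin-true x∈Ord Ps)) (subst (_≡ true) (sym (conjoin-true x∈Ord Ps)))) ,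
  (λ x x∈Ord M1∧t → trans (conjoin-true x∈Ord Ps) (∧-monoˡ-true (M1⇒N x x∈Ord) M1∧t)) ,
  (k , k≤ℓ+h , ⊓-glb (≤-trans 2≤ℓ (m≤m+n ℓ h)) 2≤n , conjoin-normal) ,
  ≤-trans (dnfDeg-normalized conjoin-normal) (∸-monoˡ-≤ 1 k≤ℓ+h) ,
  length+h∸1≤deg+termDeg+1 (zero ∷ rest) (M1-weakening-degree 2≤n N-normal M1⇒N) ,
  Ẽ-cong (suc m) (λ x x∈Ord → conjoin-value x∈Ord Ps)
  where
  open Conjunction (zero ∷ rest) h
  2≤n : 2 ≤ suc m
  2≤n = ≤-trans 2≤ℓ (Unique⇒length≤ q!)
  k≤ℓ+h : k ≤ ℓ + h
  k≤ℓ+h = m⊓n≤m _ _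
  conjoin-normal : All (IsNormTerm k) (conjoin Ps)
  conjoin-normal = conjoin-normalized (here refl) |Ps|≡h
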